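{- Let $n\geq 1$ and let $(\sigma,\tau)\in Av_n((12,12))$. Then $\Gamma(\sigma,\tau)$ is a configuration of size $n$, i.e. the $n$ points $(r_\sigma(i),l_\tau(i))$, $1\le i\le n$, are pairwise distinct and all lie in $T_n$.
   Context: For $n\ge1$ let $[n]=\{1,\dots,n\}$ and $S_n$ the set of permutations of $[n]$. A 3-permutation of size $n$ is a pair $(\sigma,\tau)\in S_n\times S_n$. For $(\pi,\rho)\in S_k\times S_k$, a 3-permutation $(\sigma,\tau)$ of size $n$ contains the pattern $(\pi,\rho)$ if there are indices $i_1<\dots<i_k$ in $[n]$ such that for all $a,b\in[k]$: $\sigma(i_a)<\sigma(i_b)\iff\pi(a)<\pi(b)$ and $\tau(i_a)<\tau(i_b)\iff\rho(a)<\rho(b)$ (the same indices for both components); otherwise it avoids $(\pi,\rho)$. $Av_n(\text{patterns})$ denotes the set of 3-permutations of size $n$ avoiding all listed patterns; $(12,12)$ denotes the pattern (identity of $S_2$, identity of $S_2$). For $\sigma\in S_n$ and $i\in[n]$, $r_\sigma(i)=\#\{j: i<j\le n,\ \sigma(j)<\sigma(i)\}$ and $l_\sigma(i)=\#\{j:1\le j<i,\ \sigma(j)>\sigma(i)\}$. Define $\Gamma(\sigma,\tau)=\{(r_\sigma(i),l_\tau(i)) : i\in[n]\}\subset\mathbb{Z}^2$. Let $T_n=\{(x,y)\in\mathbb{Z}^2: x\ge0,\ y\ge0,\ x+y<n\}$; a configuration of size $n$ is a set of exactly $n$ points of $T_n$. -}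

module Defs where

open import Data.Nat using (ℕ; suc; _+_; _<_)
open import Data.Fin using (Fin; toℕ)
import Data.Fin as F
open import Data.Fin.Properties using (_<?_)
open import Data.Fin.Permutation using (Permutation′; _⟨$⟩ʳ_)
import Data.Fin.Permutation as P
open import Data.List using (List; length; filter; allFin)
open import Data.Product using (_×_; _,_; Σ; ∃; proj₁; proj₂)
open import Relation.Binary.PropositionalEquality using (_≡_)
open import Relation.Nullary using (¬_)
open import Relation.Nullary.Decidable using (_×-dec_)

-- A 3-permutation of size n: a pair of permutations of [n] (Fin n = {0..n-1}).
ThreePerm : ℕ → Set
ThreePerm n = Permutation′ n × Permutation′ n

StrictlyIncreasing : {k n : ℕ} → (Fin k → Fin n) → Set
StrictlyIncreasing {k} f = ∀ (a b : Fin k) → a F.< b → f a F.< f b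

Contains : {n k : ℕ} → ThreePerm n → ThreePerm k → Set
Contains {n} {k} (σ , τ) (π , ρ) =
  Σ (Fin k → Fin n) λ ι → StrictlyIncreasing ι ×
    (∀ (a b : Fin k) →
      ((σ ⟨$⟩ʳ ι a F.< σ ⟨$⟩ʳ ι b → π ⟨$⟩ʳ a F.< π ⟨$⟩ʳ b) ×
       (π ⟨$⟩ʳ a F.< π ⟨$⟩ʳ b → σ ⟨$⟩ʳ ι a F.< σ ⟨$⟩ʳ ι b)) ×
      ((τ ⟨$⟩ʳ ι a F.< τ ⟨$⟩ʳ ι b → ρ ⟨$⟩ʳ a F.< ρ ⟨$⟩ʳ b) ×
       (ρ ⟨$⟩ʳ a F.< ρ ⟨$⟩ʳ b → τ ⟨$⟩ʳ ι a F.< τ ⟨$⟩ʳ ι b)))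

Avoids : {n k : ℕ} → ThreePerm n → ThreePerm k → Set
Avoids s p = ¬ Contains s p

id₂ : Permutation′ 2
id₂ = P.id

p12-12 : ThreePerm 2
p12-12 = id₂ , id₂

r : {n : ℕ} → Permutation′ n → Fin n → ℕ
r {n} σ i = length (filter (λ j → (i <? j) ×-dec (σ ⟨$⟩ʳ j <? σ ⟨$⟩ʳ i)) (allFin n))

l : {n : ℕ} → Permutation′ n → Fin n → ℕ
l {n} σ i = length (filter (λ j → (j <? i) ×-dec (σ ⟨$⟩ʳ i <? σ ⟨$⟩ʳ j)) (allFin n))

-- The point of Γ(σ,τ) indexed by i; Γ(σ,τ) is the image of this map.
Γpt : {n : ℕ} → ThreePerm n → Fin n → ℕ × ℕ
Γpt (σ , τ) i = r σ i , l τ i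

InT : ℕ → ℕ × ℕ → Set
InT n (x , y) = x + y < n

-- Γ(σ,τ) is a configuration of size n: its n defining points are pairwise
-- distinct (so the set has exactly n elements) and all lie in T_n.
IsConfigurationΓ : {n : ℕ} → ThreePerm n → Set
IsConfigurationΓ {n} s =
  (∀ (i j : Fin n) → Γpt s i ≡ Γpt s j → i ≡ j) × (∀ (i : Fin n) → InT n (Γpt s i))

{-# OPTIONS --safe #-}
module Submission where

-- For i < j, avoiding (12,12) makes (i, j) an inversion of σ or of τ. An inversion of σ
-- gives r_σ(j) < r_σ(i): every index counted by r_σ(j) is counted by r_σ(i), and so is j.
-- Dually, an inversion of τ gives l_τ(i) < l_τ(j). Hence the points of Γ are distinct.
-- They lie in T_n because r_σ(i) and l_τ(i) count disjoint sets of indices (those after i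
-- and those before i), neither containing i.

open import Defs
open import Data.Nat using (ℕ; _≥_; _≤_; _<_; _+_; s≤s; z<s)
open import Data.Nat.Properties using (m≤n⇒m≤1+n; +-suc; module ≤-Reasoning)
import Data.Nat.Properties as ℕ
open import Data.Fin using (Fin; zero; suc)
import Data.Fin as F
open import Data.Fin.Properties using (<-cmp; <-irrefl; <-asym; <-trans; <⇒≢)
open import Data.Fin.Permutation using (Permutation′; _⟨$⟩ʳ_)
open import Data.List using ([]; _∷_; length; filter; allFin)
open import Data.List.Properties using (length-tabulate; filter-notAll)
open import Data.List.Membership.Propositional using (_∈_; lose)
open import Data.List.Membership.Propositional.Properties using (∈-allFin)
open import Data.List.Relation.Unary.Any using (here; there)
open import Data.List.Relation.Binary.Sublist.Propositional using (⊆-refl)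
open import Data.List.Relation.Binary.Sublist.Propositional.Properties using (filter⁺; length-mono-≤)
open import Data.Product using (_,_; proj₁; proj₂)
open import Data.Sum using (_⊎_; inj₁; inj₂; [_,_])
open import Function using (id)
open import Function.Bundles using (Injection)
open import Function.Properties.Inverse using (↔⇒↣)
open import Relation.Binary using (tri<; tri≈; tri>)
open import Relation.Binary.PropositionalEquality using (_≡_; _≢_; refl; sym; trans; cong)
open import Relation.Nullary using (yes; no; contradiction)
open import Relation.Unary using (Pred; Decidable; _⊆_; _⊥_; _∉_)
open import Relation.Unary.Properties using (_∪?_)

module _ {a p q} {A : Set a} {P : Pred A p} {Q : Pred A q}
         (P? : Decidable P) (Q? : Decidable Q) where

  length-filter-⊆ : P ⊆ Q → ∀ xs → length (filter P? xs) ≤ length (filter Q? xs)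
  length-filter-⊆ P⊆Q xs = length-mono-≤ (filter⁺ P? Q? (λ { refl → P⊆Q }) (⊆-refl {x = xs}))

  length-filter-⊂ : P ⊆ Q → ∀ {y xs} → y ∈ xs → Q y → y ∉ P →
                    length (filter P? xs) < length (filter Q? xs)
  length-filter-⊂ P⊆Q {xs = y ∷ xs} (here refl) Qy ¬Py with P? y | Q? y
  ... | yes Py | _      = contradiction Py ¬Py
  ... | no _   | no ¬Qy = contradiction Qy ¬Qy
  ... | no _   | yes _  = s≤s (length-filter-⊆ P⊆Q xs)
  length-filter-⊂ P⊆Q {xs = x ∷ xs} (there y∈xs) Qy ¬Py
    with ih ← length-filter-⊂ P⊆Q y∈xs Qy ¬Py | P? x | Q? x
  ... | yes _  | yes _  = s≤s ih
  ... | no _   | yes _  = m≤n⇒m≤1+n ih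
  ... | no _   | no _   = ih
  ... | yes Px | no ¬Qx = contradiction (P⊆Q Px) ¬Qx

  length-filter-∪ : P ⊥ Q → ∀ xs →
                    length (filter (P? ∪? Q?) xs) ≡ length (filter P? xs) + length (filter Q? xs)
  length-filter-∪ P⊥Q []       = refl
  length-filter-∪ P⊥Q (x ∷ xs) with ih ← length-filter-∪ P⊥Q xs | P? x | Q? x
  ... | yes Px | yes Qx = contradiction (Px , Qx) P⊥Q
  ... | yes _  | no _   = cong ℕ.suc ih
  ... | no _   | yes _  = trans (cong ℕ.suc ih) (sym (+-suc _ _))
  ... | no _   | no _   = ih

  length-filter-⊥ : P ⊥ Q → ∀ {y xs} → y ∈ xs → y ∉ P → y ∉ Q →
                    length (filter P? xs) + length (filter Q? xs) < length xs
  length-filter-⊥ P⊥Q {xs = xs} y∈xs ¬Py ¬Qy = begin-strict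
    length (filter P? xs) + length (filter Q? xs) ≡⟨ sym (length-filter-∪ P⊥Q xs) ⟩
    length (filter (P? ∪? Q?) xs)                 <⟨ filter-notAll (P? ∪? Q?) xs (lose y∈xs [ ¬Py , ¬Qy ]) ⟩
    length xs                                     ∎
    where open ≤-Reasoning

module _ {n : ℕ} where

  permutation-injective : (σ : Permutation′ n) {i j : Fin n} → σ ⟨$⟩ʳ i ≡ σ ⟨$⟩ʳ j → i ≡ j
  permutation-injective σ = Injection.injective (↔⇒↣ σ)

  r+l<n : (σ τ : Permutation′ n) (i : Fin n) → r σ i + l τ i < n
  r+l<n σ τ i = begin-strict
    r σ i + l τ i     <⟨ length-filter-⊥ _ _ (λ ((i<j , _) , (j<i , _)) → <-asym i<j j<i) (∈-allFin i)
                           (λ (i<i , _) → <-irrefl refl i<i) (λ (i<i , _) → <-irrefl refl i<i) ⟩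
    length (allFin n) ≡⟨ length-tabulate id ⟩
    n                 ∎
    where open ≤-Reasoning

  inversion⇒r> : (σ : Permutation′ n) {i j : Fin n} → i F.< j → σ ⟨$⟩ʳ j F.< σ ⟨$⟩ʳ i →
                 r σ j < r σ i
  inversion⇒r> σ {j = j} i<j σj<σi = length-filter-⊂ _ _
    (λ (j<k , σk<σj) → <-trans i<j j<k , <-trans σk<σj σj<σi)
    (∈-allFin j) (i<j , σj<σi) (λ (j<j , _) → <-irrefl refl j<j)

  inversion⇒l< : (τ : Permutation′ n) {i j : Fin n} → i F.< j → τ ⟨$⟩ʳ j F.< τ ⟨$⟩ʳ i →
                 l τ i < l τ j
  inversion⇒l< τ {i} i<j τj<τi = length-filter-⊂ _ _
    (λ (k<i , τi<τk) → <-trans k<i i<j , <-trans τj<τi τi<τk)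
    (∈-allFin i) (i<j , τj<τi) (λ (i<i , _) → <-irrefl refl i<i)

  pair : Fin n → Fin n → Fin 2 → Fin n
  pair i j zero    = i
  pair i j (suc _) = j

  module _ {m : ℕ} (f : Fin n → Fin m) {i j : Fin n} (fi<fj : f i F.< f j) where

    pair-preserves-< : ∀ a b → a F.< b → f (pair i j a) F.< f (pair i j b)
    pair-preserves-< zero       (suc _)    _         = fi<fj
    pair-preserves-< (suc zero) (suc zero) (s≤s ())

    pair-reflects-< : ∀ a b → f (pair i j a) F.< f (pair i j b) → a F.< b
    pair-reflects-< zero       zero       fi<fi = contradiction fi<fi (<-irrefl refl)
    pair-reflects-< zero       (suc _)    _     = z<s
    pair-reflects-< (suc _)    zero       fj<fi = contradiction fi<fj (<-asym fj<fi)
    pair-reflects-< (suc zero) (suc zero) fj<fj = contradiction fj<fj (<-irrefl refl)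

  common-non-inversion⇒contains-12-12 : (σ τ : Permutation′ n) {i j : Fin n} → i F.< j →
    σ ⟨$⟩ʳ i F.< σ ⟨$⟩ʳ j → τ ⟨$⟩ʳ i F.< τ ⟨$⟩ʳ j → Contains (σ , τ) p12-12
  common-non-inversion⇒contains-12-12 σ τ {i} {j} i<j σi<σj τi<τj =
    pair i j , pair-preserves-< id i<j , λ a b →
      (pair-reflects-< (σ ⟨$⟩ʳ_) σi<σj a b , pair-preserves-< (σ ⟨$⟩ʳ_) σi<σj a b) ,
      (pair-reflects-< (τ ⟨$⟩ʳ_) τi<τj a b , pair-preserves-< (τ ⟨$⟩ʳ_) τi<τj a b)

  avoids-12-12⇒inversion : (σ τ : Permutation′ n) → Avoids (σ , τ) p12-12 →
    ∀ {i j} → i F.< j → σ ⟨$⟩ʳ j F.< σ ⟨$⟩ʳ i ⊎ τ ⟨$⟩ʳ j F.< τ ⟨$⟩ʳ i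
  avoids-12-12⇒inversion σ τ avoids {i} {j} i<j
    with <-cmp (σ ⟨$⟩ʳ i) (σ ⟨$⟩ʳ j) | <-cmp (τ ⟨$⟩ʳ i) (τ ⟨$⟩ʳ j)
  ... | tri> _ _ σj<σi  | _                = inj₁ σj<σi
  ... | _               | tri> _ _ τj<τi   = inj₂ τj<τi
  ... | tri≈ _ σi≡σj _  | _                = contradiction (permutation-injective σ σi≡σj) (<⇒≢ i<j)
  ... | _               | tri≈ _ τi≡τj _   = contradiction (permutation-injective τ τi≡τj) (<⇒≢ i<j)
  ... | tri< σi<σj _ _  | tri< τi<τj _ _   =
    contradiction (common-non-inversion⇒contains-12-12 σ τ i<j σi<σj τi<τj) avoids

  Γpt-separates : (σ τ : Permutation′ n) → Avoids (σ , τ) p12-12 →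
    ∀ {i j} → i F.< j → Γpt (σ , τ) i ≢ Γpt (σ , τ) j
  Γpt-separates σ τ avoids i<j Γi≡Γj with avoids-12-12⇒inversion σ τ avoids i<j
  ... | inj₁ σj<σi = ℕ.<-irrefl (cong proj₁ (sym Γi≡Γj)) (inversion⇒r> σ i<j σj<σi)
  ... | inj₂ τj<τi = ℕ.<-irrefl (cong proj₂ Γi≡Γj) (inversion⇒l< τ i<j τj<τi)

  Γpt-injective : (σ τ : Permutation′ n) → Avoids (σ , τ) p12-12 →
    ∀ i j → Γpt (σ , τ) i ≡ Γpt (σ , τ) j → i ≡ j
  Γpt-injective σ τ avoids i j Γi≡Γj with <-cmp i j
  ... | tri< i<j _ _ = contradiction Γi≡Γj (Γpt-separates σ τ avoids i<j)
  ... | tri≈ _ i≡j _ = i≡j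
  ... | tri> _ _ j<i = contradiction (sym Γi≡Γj) (Γpt-separates σ τ avoids j<i)

mainTheorem1 : (n : ℕ) → n ≥ 1 → (s : ThreePerm n) → Avoids s p12-12 →
    IsConfigurationΓ s
mainTheorem1 n _ (σ , τ) avoids = Γpt-injective σ τ avoids , r+l<n σ τ
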